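{- Define the unitary convolution $(a\oplus b)(n)=\sum_{d\mid n,\ \gcd(d,n/d)=1}a(d)b(n/d)$ and the functions $\tau_k^*$ for $k\ge2$ recursively by $\tau_2^*(n)=\sigma_0^*(n)$ (the number of unitary divisors $d\mid n$ with $\gcd(d,n/d)=1$) and $\tau_{k+1}^*=\tau_k^*\oplus 1$, where $1$ denotes the constant function $1$. Then for every integer $k\ge2$ and every positive integer $n$, $$\sum_{d\mid n}\tau_k^*(d)=\sigma_0(n^k),$$ where $\sigma_0(m)$ is the number of divisors of $m$. -}

module Defs where

open import Data.Nat using (ℕ; zero; suc; _+_; _*_; _^_; _/_; _≟_)
open import Data.Nat.Divisibility using (_∣_; _∣?_)
open import Data.Nat.GCD using (gcd)
open import Data.List using (List; []; _∷_; applyUpTo; filter; length; map)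
open import Data.Nat.ListAction using (sum)
open import Relation.Nullary using (does)
open import Data.Bool using (if_then_else_)

-- Arithmetic functions on ℕ (values at 0 are irrelevant; we only use n ≥ 1).
ArithFun : Set
ArithFun = ℕ → ℕ

-- The positive divisors of n, listed as  1, …, n  filtered by divisibility.
-- Each element is represented as  suc i  (so the divisor is nonzero by construction).
divisorsPred : ℕ → List ℕ
divisorsPred n = filter (λ i → suc i ∣? n) (applyUpTo (λ i → i) n)

σ₀ : ℕ → ℕ
σ₀ m = length (divisorsPred m)

divisorSum : ArithFun → ℕ → ℕ
divisorSum f n = sum (map (λ i → f (suc i)) (divisorsPred n))

_⊕_ : ArithFun → ArithFun → ArithFun
(a ⊕ b) n = sum (map (λ i → if does (gcd (suc i) (n / suc i) ≟ 1)
                              then a (suc i) * b (n / suc i)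
                              else 0)
                     (divisorsPred n))

σ₀* : ArithFun
σ₀* n = length (filter (λ i → gcd (suc i) (n / suc i) ≟ 1) (divisorsPred n))

one : ArithFun
one _ = 1

-- τ*ₖ, indexed directly by k.  Only k ≥ 2 is meaningful:
-- τ*₂ = σ₀*,  τ*_{k+1} = τ*ₖ ⊕ 1.  (For k < 2 we set τ*ₖ = σ₀* as a dummy
-- value; the theorem only uses k ≥ 2.)
τ* : ℕ → ArithFun
τ* zero                = σ₀*
τ* (suc zero)          = σ₀*
τ* (suc (suc zero))    = σ₀*
τ* (suc (suc (suc j))) = τ* (suc (suc j)) ⊕ one

module Submission where

-- Write 1⊕ⱼ for the (j+1)-fold unitary convolution 1 ⊕ ⋯ ⊕ 1, so
-- that τ*ₖ = 1⊕ₖ₋₁ for k ≥ 2 and 1⊕₀ = 1.  Both sides of the theorem are computed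
-- one prime at a time.  Fix a prime p and m with p ∤ m.  Every divisor of p^a·m is
-- uniquely p^b·e with b ≤ a and e ∣ m, so a divisor sum over p^a·m splits into the
-- a+1 blocks b = 0, …, a, each of which is a divisor sum over m.
--   * A divisor p^b·e of p^a·u (p ∤ u, e ∣ u) is unitary iff e is a unitary divisor
--     of u and b ∈ {0, a}.  By induction on j this gives 1⊕ⱼ(p^a·u) = (j+1)·1⊕ⱼ(u)
--     for a ≥ 1.
--   * Hence Σ_{d ∣ p^a·m} 1⊕ⱼ(d) = (1 + a(j+1)) · Σ_{d ∣ m} 1⊕ⱼ(d); for j = 0 this
--     reads σ₀(p^a·m) = (a+1)·σ₀(m).
-- Together these give Σ_{d ∣ n} 1⊕ⱼ(d) = σ₀(n^{j+1}) by strong induction on n,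
-- splitting off the full power of a prime divisor of n.

open import Defs
open import Data.Bool using (Bool; true; false; if_then_else_)
open import Data.Empty using (⊥-elim)
open import Data.List using (List; []; _∷_; _++_; map; filter; length; upTo)
open import Data.List.Properties using (map-∘; map-++; map-cong)
open import Data.List.Membership.Propositional using (_∈_)
open import Data.List.Membership.Propositional.Properties
  using (∈-map⁺; ∈-map⁻; ∈-filter⁺; ∈-filter⁻; ∈-upTo⁺; ∈-++⁺ˡ; ∈-++⁺ʳ; ∈-++⁻)
open import Data.List.Membership.Propositional.Properties.WithK using (unique∧set⇒bag)
open import Data.List.Relation.Unary.Any using (here; there)
open import Data.List.Relation.Unary.Unique.Propositional using (Unique)
import Data.List.Relation.Unary.Unique.Propositional.Properties as Unique
open import Data.List.Relation.Binary.Disjoint.Propositional using (Disjoint)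
open import Data.List.Relation.Binary.Permutation.Propositional using (_↭_)
import Data.List.Relation.Binary.Permutation.Propositional.Properties as Perm
open import Data.List.Relation.Binary.BagAndSetEquality using (∼bag⇒↭)
open import Data.List.Relation.Unary.All using (_∷_)
open import Data.Nat
open import Data.Nat.Properties
open import Data.Nat.Divisibility
open import Data.Nat.GCD using (gcd)
open import Data.Nat.Coprimality as Coprimality
  using (Coprime; coprime?; coprime-divisor; coprime⇒gcd≡1; gcd≡1⇒coprime)
open import Data.Nat.DivMod using (m*n/n≡m)
open import Data.Nat.Induction using (<-rec)
open import Data.Nat.ListAction using (sum; product)
open import Data.Nat.ListAction.Properties using (sum-++; sum-↭)
open import Data.Nat.Primality
  using (Prime; prime⇒nonZero; prime⇒nonTrivial; prime⇒irreducible)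
open import Data.Nat.Primality.Factorisation using (factorise)
open import Data.Nat.Solver using (module +-*-Solver)
open import Data.Product using (∃-syntax; _×_; _,_; proj₂)
open import Data.Sum using (inj₁; inj₂)
open import Function.Bundles using (mk⇔)
open import Relation.Binary.PropositionalEquality
open import Relation.Nullary using (¬_; yes; no; does)
open import Relation.Nullary.Decidable using (does-⇔; dec-false)
open import Relation.Unary using (Decidable)

open +-*-Solver
open ≡-Reasoning

sum-map-cong-∈ : ∀ {A : Set} (xs : List A) {f g : A → ℕ} →
  (∀ {x} → x ∈ xs → f x ≡ g x) → sum (map f xs) ≡ sum (map g xs)
sum-map-cong-∈ []       _  = refl
sum-map-cong-∈ (x ∷ xs) eq = cong₂ _+_ (eq (here refl)) (sum-map-cong-∈ xs (λ x∈ → eq (there x∈)))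

sum-map-* : ∀ {A : Set} (xs : List A) c (f : A → ℕ) →
  sum (map (λ x → c * f x) xs) ≡ c * sum (map f xs)
sum-map-* []       c f = sym (*-zeroʳ c)
sum-map-* (x ∷ xs) c f = begin
  c * f x + sum (map (λ x → c * f x) xs) ≡⟨ cong (c * f x +_) (sum-map-* xs c f) ⟩
  c * f x + c * sum (map f xs)           ≡⟨ *-distribˡ-+ c (f x) _ ⟨
  c * (f x + sum (map f xs))             ∎

sum-map-0 : ∀ {A : Set} (xs : List A) → sum (map (λ _ → 0) xs) ≡ 0
sum-map-0 []       = refl
sum-map-0 (x ∷ xs) = sum-map-0 xs

length-filter : ∀ {A : Set} {P : A → Set} (P? : Decidable P) (xs : List A) →
  length (filter P? xs) ≡ sum (map (λ x → if does (P? x) then 1 else 0) xs)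
length-filter P? []       = refl
length-filter P? (x ∷ xs) with does (P? x)
... | false = length-filter P? xs
... | true  = cong suc (length-filter P? xs)

-- The positive divisors of n as actual numbers (Defs lists them shifted down by one).
D : ℕ → List ℕ
D n = map suc (divisorsPred n)

divisorSum-via-D : ∀ f n → divisorSum f n ≡ sum (map f (D n))
divisorSum-via-D f n = cong sum (map-∘ (divisorsPred n))

divisorSum-cong : ∀ {f g : ArithFun} → (∀ x → f x ≡ g x) → ∀ n → divisorSum f n ≡ divisorSum g n
divisorSum-cong f≗g n = cong sum (map-cong (λ i → f≗g (suc i)) (divisorsPred n))

σ₀-via-divisorSum : ∀ n → σ₀ n ≡ divisorSum one n
σ₀-via-divisorSum n = length-as-sum (divisorsPred n)
  where
    length-as-sum : (xs : List ℕ) → length xs ≡ sum (map (λ _ → 1) xs)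
    length-as-sum []       = refl
    length-as-sum (x ∷ xs) = cong suc (length-as-sum xs)

∣⇒∈D : ∀ {d n} .{{_ : NonZero n}} → d ∣ n → d ∈ D n
∣⇒∈D {zero}  {n} 0∣n = ⊥-elim (≢-nonZero⁻¹ n (0∣⇒≡0 0∣n))
∣⇒∈D {suc i} {n} d∣n = ∈-map⁺ suc (∈-filter⁺ (λ j → suc j ∣? n) (∈-upTo⁺ (∣⇒≤ d∣n)) d∣n)

∈D⇒∣ : ∀ {d n} → d ∈ D n → d ∣ n × NonZero d
∈D⇒∣ {n = n} d∈ with ∈-map⁻ suc d∈
... | i , i∈ , refl = proj₂ (∈-filter⁻ (λ j → suc j ∣? n) {xs = upTo n} i∈) , _

D-unique : ∀ n → Unique (D n)
D-unique n = Unique.map⁺ suc-injective (Unique.filter⁺ (λ i → suc i ∣? n) (Unique.upTo⁺ n))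

same-members⇒↭ : ∀ {xs ys : List ℕ} → Unique xs → Unique ys →
  (∀ {x} → x ∈ xs → x ∈ ys) → (∀ {x} → x ∈ ys → x ∈ xs) → xs ↭ ys
same-members⇒↭ ux uy to from = ∼bag⇒↭ (unique∧set⇒bag ux uy (mk⇔ to from))

^-distribʳ-* : ∀ x y k → (x * y) ^ k ≡ x ^ k * y ^ k
^-distribʳ-* x y zero    = refl
^-distribʳ-* x y (suc k) = begin
  x * y * (x * y) ^ k       ≡⟨ cong (x * y *_) (^-distribʳ-* x y k) ⟩
  x * y * (x ^ k * y ^ k)   ≡⟨ solve 4 (λ x y a b → x :* y :* (a :* b) := x :* a :* (y :* b)) refl x y (x ^ k) (y ^ k) ⟩
  x * x ^ k * (y * y ^ k)   ∎

^-mono-∣ : ∀ p {b a} → b ≤ a → p ^ b ∣ p ^ a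
^-mono-∣ p {b} {a} b≤a = divides (p ^ (a ∸ b)) (begin
  p ^ a               ≡⟨ cong (p ^_) (m+[n∸m]≡n b≤a) ⟨
  p ^ (b + (a ∸ b))   ≡⟨ ^-distribˡ-+-* p b (a ∸ b) ⟩
  p ^ b * p ^ (a ∸ b) ≡⟨ *-comm (p ^ b) _ ⟩
  p ^ (a ∸ b) * p ^ b ∎)

∤⇒nonZero : ∀ {p m} → ¬ p ∣ m → NonZero m
∤⇒nonZero {p} {zero}  p∤0 = ⊥-elim (p∤0 (p ∣0))
∤⇒nonZero {p} {suc m} _   = _

coprime-1 : ∀ {x} → Coprime x 1
coprime-1 (_ , d∣1) = ∣1⇒≡1 d∣1

coprime-* : ∀ {x y z} → Coprime x y → Coprime x z → Coprime x (y * z)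
coprime-* cxy cxz (c∣x , c∣yz) = cxz (c∣x , coprime-divisor (λ (d∣c , d∣y) → cxy (∣-trans d∣c c∣x , d∣y)) c∣yz)

coprime-^ : ∀ {x y} → Coprime x y → ∀ a → Coprime x (y ^ a)
coprime-^ c zero    = coprime-1
coprime-^ c (suc a) = coprime-* c (coprime-^ c a)

p-part : ∀ p .{{_ : NonTrivial p}} n .{{_ : NonZero n}} →
  ∃[ a ] ∃[ m ] (n ≡ p ^ a * m × ¬ p ∣ m)
p-part p (suc k) = <-rec P split (suc k)
  where
    P : ℕ → Set
    P n = {{NonZero n}} → ∃[ a ] ∃[ m ] (n ≡ p ^ a * m × ¬ p ∣ m)
    split : ∀ n → (∀ {q} → q < n → P q) → P n
    split n rec with p ∣? n
    ... | no p∤n = 0 , n , sym (*-identityˡ n) , p∤n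
    ... | yes p∣n with rec (quotient-< p∣n) {{quotient≢0 p∣n}}
    ...   | a , m , q≡ , p∤m = suc a , m , n≡ , p∤m
      where
        n≡ : n ≡ p ^ suc a * m
        n≡ = begin
          n                 ≡⟨ m∣n⇒n≡m*quotient p∣n ⟩
          p * quotient p∣n  ≡⟨ cong (p *_) q≡ ⟩
          p * (p ^ a * m)   ≡⟨ *-assoc p (p ^ a) m ⟨
          p ^ suc a * m     ∎

Σ≤ : ℕ → (ℕ → ℕ) → ℕ
Σ≤ zero    h = h 0
Σ≤ (suc a) h = Σ≤ a h + h (suc a)

Σ≤-head-rest : ∀ a {h : ℕ → ℕ} {X Y} → h 0 ≡ X → (∀ b → h (suc b) ≡ Y) → Σ≤ a h ≡ X + a * Y
Σ≤-head-rest zero    h0 _  = trans h0 (sym (+-identityʳ _))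
Σ≤-head-rest (suc a) {h} {X} {Y} h0 hs = begin
  Σ≤ a h + h (suc a)  ≡⟨ cong₂ _+_ (Σ≤-head-rest a h0 hs) (hs a) ⟩
  X + a * Y + Y       ≡⟨ solve 3 (λ x a y → x :+ a :* y :+ y := x :+ (y :+ a :* y)) refl X a Y ⟩
  X + suc a * Y       ∎

Σ≤-ends : ∀ i {h : ℕ → ℕ} {X Y} → h 0 ≡ X → (∀ b → 0 < b → b ≤ i → h b ≡ 0) → h (suc i) ≡ Y →
  Σ≤ (suc i) h ≡ X + Y
Σ≤-ends i {h} {X} h0 hmid hi = cong₂ _+_ (initial i ≤-refl) hi
  where
    initial : ∀ c → c ≤ i → Σ≤ c h ≡ X
    initial zero    _   = h0
    initial (suc c) c<i = begin
      Σ≤ c h + h (suc c)  ≡⟨ cong₂ _+_ (initial c (<⇒≤ c<i)) (hmid (suc c) z<s c<i) ⟩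
      X + 0               ≡⟨ +-identityʳ X ⟩
      X                   ∎

isUnitary : ℕ → ℕ → Bool
isUnitary N zero        = false
isUnitary N d@(suc _)   = does (gcd d (N / d) ≟ 1)

isUnitary-spec : ∀ {N d} y .{{_ : NonZero d}} → N ≡ y * d → isUnitary N d ≡ does (coprime? d y)
isUnitary-spec {d = suc i} y refl = begin
  does (gcd (suc i) (y * suc i / suc i) ≟ 1)  ≡⟨ cong (λ z → does (gcd (suc i) z ≟ 1)) (m*n/n≡m y (suc i)) ⟩
  does (gcd (suc i) y ≟ 1)                    ≡⟨ does-⇔ (mk⇔ gcd≡1⇒coprime coprime⇒gcd≡1) (gcd (suc i) y ≟ 1) (coprime? (suc i) y) ⟩
  does (coprime? (suc i) y)                   ∎

unitaryTerm : ArithFun → ℕ → ℕ → ℕ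
unitaryTerm f N d = if isUnitary N d then f d * 1 else 0

⊕one-via-D : ∀ f N → (f ⊕ one) N ≡ sum (map (unitaryTerm f N) (D N))
⊕one-via-D f N = cong sum (map-∘ (divisorsPred N))

1⊕ : ℕ → ArithFun
1⊕ zero    = one
1⊕ (suc j) = 1⊕ j ⊕ one

1⊕-at-1 : ∀ j → 1⊕ j 1 ≡ 1
1⊕-at-1 zero    = refl
1⊕-at-1 (suc j) = trans (+-identityʳ _) (trans (*-identityʳ _) (1⊕-at-1 j))

⊕-congˡ : ∀ {f g : ArithFun} (h : ArithFun) → (∀ x → f x ≡ g x) → ∀ n → (f ⊕ h) n ≡ (g ⊕ h) n
⊕-congˡ h f≗g n = cong sum (map-cong (λ i → cong (λ z → if does (gcd (suc i) (n / suc i) ≟ 1)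
                                                          then z * h (n / suc i) else 0)
                                                 (f≗g (suc i)))
                                     (divisorsPred n))

-- τ*ₖ agrees with 1⊕ₖ₋₁; the base case says σ₀* = 1 ⊕ 1 (counting unitary divisors).
τ*≗1⊕ : ∀ j n → τ* (suc (suc j)) n ≡ 1⊕ (suc j) n
τ*≗1⊕ zero    n = length-filter (λ i → gcd (suc i) (n / suc i) ≟ 1) (divisorsPred n)
τ*≗1⊕ (suc j) n = ⊕-congˡ one (τ*≗1⊕ j) n

unitaryTerm-scale : ∀ {f g : ArithFun} {N N′ d d′} c → isUnitary N d ≡ isUnitary N′ d′ →
  f d ≡ c * g d′ → unitaryTerm f N d ≡ c * unitaryTerm g N′ d′
unitaryTerm-scale {N′ = N′} {d′ = d′} c same f≡ with isUnitary N′ d′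
... | true  rewrite same = trans (*-identityʳ _) (trans f≡ (cong (c *_) (sym (*-identityʳ _))))
... | false rewrite same = sym (*-zeroʳ c)

unitaryTerm-non : ∀ {f : ArithFun} {N d} → isUnitary N d ≡ false → unitaryTerm f N d ≡ 0
unitaryTerm-non not-unitary rewrite not-unitary = refl

module AtPrime {p : ℕ} (p-prime : Prime p) where

  private instance
    p≢0 : NonZero p
    p≢0 = prime⇒nonZero p-prime
    p>1 : NonTrivial p
    p>1 = prime⇒nonTrivial p-prime

  ∤⇒coprime : ∀ {e} → ¬ p ∣ e → Coprime e p
  ∤⇒coprime p∤e {c} (c∣e , c∣p) with prime⇒irreducible p-prime c∣p
  ... | inj₁ c≡1  = c≡1
  ... | inj₂ refl = ⊥-elim (p∤e c∣e)

  ∤-^ : ∀ {m} → ¬ p ∣ m → ∀ k → ¬ p ∣ m ^ k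
  ∤-^ p∤m k p∣m^k = nonTrivial⇒≢1 (coprime-^ (Coprimality.sym (∤⇒coprime p∤m)) k (∣-refl , p∣m^k))

  ∤-∈D : ∀ {m e} → ¬ p ∣ m → e ∈ D m → ¬ p ∣ e
  ∤-∈D p∤m e∈ p∣e with ∈D⇒∣ e∈
  ... | e∣m , _ = p∤m (∣-trans p∣e e∣m)

  exponent-unique : ∀ b c {e e′} → ¬ p ∣ e → ¬ p ∣ e′ → p ^ b * e ≡ p ^ c * e′ → b ≡ c
  exponent-unique zero    zero    _   _    _  = refl
  exponent-unique zero    (suc c) {e} {e′} p∤e _ eq =
    ⊥-elim (p∤e (subst (p ∣_) (trans (sym eq) (*-identityˡ e)) (∣m⇒∣m*n e′ (m∣m*n (p ^ c)))))
  exponent-unique (suc b) zero    {e} {e′} _ p∤e′ eq =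
    ⊥-elim (p∤e′ (subst (p ∣_) (trans eq (*-identityˡ e′)) (∣m⇒∣m*n e (m∣m*n (p ^ b)))))
  exponent-unique (suc b) (suc c) {e} {e′} p∤e p∤e′ eq =
    cong suc (exponent-unique b c p∤e p∤e′ (*-cancelˡ-≡ _ _ p (begin
      p * (p ^ b * e)  ≡⟨ *-assoc p (p ^ b) e ⟨
      p ^ suc b * e    ≡⟨ eq ⟩
      p ^ suc c * e′   ≡⟨ *-assoc p (p ^ c) e′ ⟩
      p * (p ^ c * e′) ∎)))

  divisor-split : ∀ {m} → ¬ p ∣ m → ∀ a {d} .{{_ : NonZero d}} → d ∣ p ^ a * m →
    ∃[ b ] ∃[ e ] (b ≤ a × e ∣ m × d ≡ p ^ b * e)
  divisor-split {m} p∤m a {d} d∣ with p-part p d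
  ... | b , e , d≡ , p∤e = b , e , b≤a , e∣m , d≡
    where
      e∣m : e ∣ m
      e∣m = coprime-divisor (coprime-^ (∤⇒coprime p∤e) a) (∣-trans (divides (p ^ b) d≡) d∣)
      -- if b > a then p^a·p ∣ p^b ∣ d ∣ p^a·m, so p ∣ m
      b≤a : b ≤ a
      b≤a with b ≤? a
      ... | yes b≤a = b≤a
      ... | no  b≰a = ⊥-elim (p∤m (*-cancelˡ-∣ (p ^ a) {{m^n≢0 p a}}
              (subst (_∣ p ^ a * m) (*-comm p (p ^ a))
                (∣-trans (^-mono-∣ p (≰⇒> b≰a)) (∣-trans (divides e (trans d≡ (*-comm (p ^ b) e))) d∣)))))

  block : ℕ → ℕ → List ℕ
  block m b = map (p ^ b *_) (D m)

  blocks : ℕ → ℕ → List ℕ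
  blocks m zero    = block m zero
  blocks m (suc a) = blocks m a ++ block m (suc a)

  ∈-blocks⁺ : ∀ {m a b e} → b ≤ a → e ∈ D m → p ^ b * e ∈ blocks m a
  ∈-blocks⁺ {a = zero}  z≤n e∈ = ∈-map⁺ (p ^ 0 *_) e∈
  ∈-blocks⁺ {m} {a = suc a} b≤ e∈ with m≤n⇒m<n∨m≡n b≤
  ... | inj₁ b≤a  = ∈-++⁺ˡ (∈-blocks⁺ {m} (≤-pred b≤a) e∈)
  ... | inj₂ refl = ∈-++⁺ʳ (blocks m a) (∈-map⁺ (p ^ suc a *_) e∈)

  ∈-blocks⁻ : ∀ {m a x} → x ∈ blocks m a → ∃[ b ] ∃[ e ] (b ≤ a × e ∈ D m × x ≡ p ^ b * e)
  ∈-blocks⁻ {a = zero} x∈ with ∈-map⁻ (p ^ 0 *_) x∈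
  ... | e , e∈ , x≡ = 0 , e , z≤n , e∈ , x≡
  ∈-blocks⁻ {m} {suc a} x∈ with ∈-++⁻ (blocks m a) x∈
  ... | inj₁ x∈ˡ with ∈-blocks⁻ {m} {a} x∈ˡ
  ...   | b , e , b≤a , e∈ , x≡ = b , e , m≤n⇒m≤1+n b≤a , e∈ , x≡
  ∈-blocks⁻ {m} {suc a} x∈ | inj₂ x∈ʳ with ∈-map⁻ (p ^ suc a *_) x∈ʳ
  ... | e , e∈ , x≡ = suc a , e , ≤-refl , e∈ , x≡

  block-unique : ∀ m b → Unique (block m b)
  block-unique m b = Unique.map⁺ (*-cancelˡ-≡ _ _ (p ^ b) {{m^n≢0 p b}}) (D-unique m)

  blocks-unique : ∀ {m} → ¬ p ∣ m → ∀ a → Unique (blocks m a)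
  blocks-unique {m} p∤m zero    = block-unique m 0
  blocks-unique {m} p∤m (suc a) = Unique.++⁺ (blocks-unique p∤m a) (block-unique m (suc a)) disjoint
    where
      disjoint : Disjoint (blocks m a) (block m (suc a))
      disjoint (x∈ˡ , x∈ʳ) with ∈-blocks⁻ {m} {a} x∈ˡ | ∈-map⁻ (p ^ suc a *_) x∈ʳ
      ... | b , e , b≤a , e∈ , x≡ | e′ , e′∈ , x≡′ =
        <⇒≢ (s≤s b≤a) (exponent-unique b (suc a) (∤-∈D p∤m e∈) (∤-∈D p∤m e′∈) (trans (sym x≡) x≡′))

  D-split : ∀ {m} → ¬ p ∣ m → ∀ a → D (p ^ a * m) ↭ blocks m a
  D-split {m} p∤m a = same-members⇒↭ (D-unique (p ^ a * m)) (blocks-unique p∤m a) to from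
    where
      instance
        m≢0 : NonZero m
        m≢0 = ∤⇒nonZero p∤m
        p^a≢0 : NonZero (p ^ a)
        p^a≢0 = m^n≢0 p a
        n≢0 : NonZero (p ^ a * m)
        n≢0 = m*n≢0 (p ^ a) m
      to : ∀ {x} → x ∈ D (p ^ a * m) → x ∈ blocks m a
      to x∈ with ∈D⇒∣ {n = p ^ a * m} x∈
      ... | x∣ , x≢0 with divisor-split p∤m a {{x≢0}} x∣
      ...   | b , e , b≤a , e∣m , refl = ∈-blocks⁺ b≤a (∣⇒∈D {n = m} e∣m)
      from : ∀ {x} → x ∈ blocks m a → x ∈ D (p ^ a * m)
      from x∈ with ∈-blocks⁻ {m} {a} x∈
      ... | b , e , b≤a , e∈ , refl with ∈D⇒∣ e∈
      ...   | e∣m , _ = ∣⇒∈D {n = p ^ a * m} (*-pres-∣ (^-mono-∣ p b≤a) e∣m)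

  sum-over-p-part : ∀ {m} → ¬ p ∣ m → ∀ a (g : ℕ → ℕ) →
    sum (map g (D (p ^ a * m))) ≡ Σ≤ a (λ b → sum (map (λ e → g (p ^ b * e)) (D m)))
  sum-over-p-part {m} p∤m a g = trans (sum-↭ (Perm.map⁺ g (D-split p∤m a))) (sum-blocks a)
    where
      sum-block : ∀ b → sum (map g (block m b)) ≡ sum (map (λ e → g (p ^ b * e)) (D m))
      sum-block b = cong sum (sym (map-∘ (D m)))
      sum-blocks : ∀ a → sum (map g (blocks m a)) ≡ Σ≤ a (λ b → sum (map (λ e → g (p ^ b * e)) (D m)))
      sum-blocks zero    = sum-block 0
      sum-blocks (suc a) = begin
        sum (map g (blocks m a ++ block m (suc a)))              ≡⟨ cong sum (map-++ g (blocks m a) _) ⟩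
        sum (map g (blocks m a) ++ map g (block m (suc a)))      ≡⟨ sum-++ (map g (blocks m a)) _ ⟩
        sum (map g (blocks m a)) + sum (map g (block m (suc a))) ≡⟨ cong₂ _+_ (sum-blocks a) (sum-block (suc a)) ⟩
        _                                                        ∎

  p∣p^ : ∀ {c} → 0 < c → p ∣ p ^ c
  p∣p^ {suc c} _ = m∣m*n (p ^ c)

  -- Unitary divisors of p^a·u for p ∤ u; a divisor e of u has cofactor q, u = q·e.
  -- e stays unitary in p^a·u: since p ∤ e, gcd(e, p^a·q) = 1 ⇔ gcd(e, q) = 1.
  unitary-low : ∀ a {u e} .{{_ : NonZero e}} → ¬ p ∣ u → e ∣ u →
    isUnitary (p ^ a * u) e ≡ isUnitary u e
  unitary-low a {u} {e} p∤u e∣u@(divides q u≡) = begin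
    isUnitary (p ^ a * u) e        ≡⟨ isUnitary-spec (p ^ a * q) (trans (cong (p ^ a *_) u≡) (sym (*-assoc (p ^ a) q e))) ⟩
    does (coprime? e (p ^ a * q))  ≡⟨ does-⇔ (mk⇔ drop add) (coprime? e _) (coprime? e q) ⟩
    does (coprime? e q)            ≡⟨ isUnitary-spec q u≡ ⟨
    isUnitary u e                  ∎
    where
      drop : Coprime e (p ^ a * q) → Coprime e q
      drop c (d∣e , d∣q) = c (d∣e , ∣n⇒∣m*n (p ^ a) d∣q)
      add : Coprime e q → Coprime e (p ^ a * q)
      add = coprime-* (coprime-^ (∤⇒coprime (λ p∣e → p∤u (∣-trans p∣e e∣u))) a)

  -- p^a·e is unitary in p^a·u iff e is unitary in u: since p ∤ q, gcd(p^a·e, q) = gcd(e, q).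
  unitary-top : ∀ a {u e} .{{_ : NonZero e}} → ¬ p ∣ u → e ∣ u →
    isUnitary (p ^ a * u) (p ^ a * e) ≡ isUnitary u e
  unitary-top a {u} {e} p∤u (divides q u≡) = begin
    isUnitary (p ^ a * u) (p ^ a * e)  ≡⟨ isUnitary-spec q {{p^a*e≢0}} (trans (cong (p ^ a *_) u≡) (solve 3 (λ x q e → x :* (q :* e) := q :* (x :* e)) refl (p ^ a) q e)) ⟩
    does (coprime? (p ^ a * e) q)      ≡⟨ does-⇔ (mk⇔ drop add) (coprime? _ q) (coprime? e q) ⟩
    does (coprime? e q)                ≡⟨ isUnitary-spec q u≡ ⟨
    isUnitary u e                      ∎
    where
      p^a*e≢0 : NonZero (p ^ a * e)
      p^a*e≢0 = m*n≢0 (p ^ a) e {{m^n≢0 p a}}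
      drop : Coprime (p ^ a * e) q → Coprime e q
      drop c (d∣e , d∣q) = c (∣n⇒∣m*n (p ^ a) d∣e , d∣q)
      add : Coprime e q → Coprime (p ^ a * e) q
      add c = Coprimality.sym (coprime-* (coprime-^ (∤⇒coprime p∤q) a) (Coprimality.sym c))
        where
          p∤q : ¬ p ∣ q
          p∤q p∣q = p∤u (∣-trans p∣q (divides e (trans u≡ (*-comm q e))))

  -- For 0 < b < a, p^b·e is not unitary in p^a·u: p divides it and its cofactor.
  unitary-mid : ∀ {a b u e} .{{_ : NonZero e}} → 0 < b → b < a → e ∣ u →
    isUnitary (p ^ a * u) (p ^ b * e) ≡ false
  unitary-mid {a} {b} {u} {e} 0<b b<a (divides q u≡) = begin
    isUnitary (p ^ a * u) (p ^ b * e)               ≡⟨ isUnitary-spec (p ^ c * q) {{p^b*e≢0}} split ⟩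
    does (coprime? (p ^ b * e) (p ^ c * q))         ≡⟨ dec-false (coprime? _ _) share-p ⟩
    false                                           ∎
    where
      c = a ∸ b
      p^b*e≢0 : NonZero (p ^ b * e)
      p^b*e≢0 = m*n≢0 (p ^ b) e {{m^n≢0 p b}}
      split : p ^ a * u ≡ p ^ c * q * (p ^ b * e)
      split = begin
        p ^ a * u              ≡⟨ cong₂ _*_ (cong (p ^_) (m+[n∸m]≡n (<⇒≤ b<a))) (sym u≡) ⟨
        p ^ (b + c) * (q * e)  ≡⟨ cong (_* (q * e)) (^-distribˡ-+-* p b c) ⟩
        p ^ b * p ^ c * (q * e) ≡⟨ solve 4 (λ x y q e → x :* y :* (q :* e) := y :* q :* (x :* e)) refl (p ^ b) (p ^ c) q e ⟩
        p ^ c * q * (p ^ b * e) ∎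
      share-p : ¬ Coprime (p ^ b * e) (p ^ c * q)
      share-p cop = nonTrivial⇒≢1 (cop (∣m⇒∣m*n e (p∣p^ 0<b) , ∣m⇒∣m*n q (p∣p^ (m<n⇒0<n∸m b<a))))

  -- The local formula for 1⊕ⱼ: 1⊕ⱼ(p^{i+1}·u) = (j+1)·1⊕ⱼ(u) for p ∤ u.  In
  -- (1⊕ⱼ ⊕ 1)(p^{i+1}·u) only the blocks b = 0 and b = i+1 contribute, giving
  -- X + (j+1)·X with X = (1⊕ⱼ ⊕ 1)(u).
  1⊕-p-part : ∀ j {u} → ¬ p ∣ u → ∀ i → 1⊕ j (p ^ suc i * u) ≡ suc j * 1⊕ j u
  1⊕-p-part zero    _   _ = refl
  1⊕-p-part (suc j) {u} p∤u i = begin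
    (1⊕ j ⊕ one) N                          ≡⟨ ⊕one-via-D (1⊕ j) N ⟩
    sum (map (unitaryTerm (1⊕ j) N) (D N))  ≡⟨ sum-over-p-part p∤u (suc i) _ ⟩
    Σ≤ (suc i) block-sum                    ≡⟨ Σ≤-ends i (sum-map-cong-∈ (D u) low) mid-sum top-sum ⟩
    X + suc j * X                           ≡⟨ cong (suc (suc j) *_) (⊕one-via-D (1⊕ j) u) ⟨
    suc (suc j) * (1⊕ j ⊕ one) u            ∎
    where
      N = p ^ suc i * u
      X = sum (map (unitaryTerm (1⊕ j) u) (D u))
      block-sum : ℕ → ℕ
      block-sum b = sum (map (λ e → unitaryTerm (1⊕ j) N (p ^ b * e)) (D u))
      low : ∀ {e} → e ∈ D u → unitaryTerm (1⊕ j) N (p ^ 0 * e) ≡ unitaryTerm (1⊕ j) u e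
      low {e} e∈ with ∈D⇒∣ e∈
      ... | e∣u , e≢0 = trans (cong (unitaryTerm (1⊕ j) N) (*-identityˡ e))
                              (cong (λ t → if t then 1⊕ j e * 1 else 0) (unitary-low (suc i) {{e≢0}} p∤u e∣u))
      mid-sum : ∀ b → 0 < b → b ≤ i → block-sum b ≡ 0
      mid-sum b 0<b b≤i = trans (sum-map-cong-∈ (D u) mid) (sum-map-0 (D u))
        where
          mid : ∀ {e} → e ∈ D u → unitaryTerm (1⊕ j) N (p ^ b * e) ≡ 0
          mid e∈ with ∈D⇒∣ e∈
          ... | e∣u , e≢0 = unitaryTerm-non {1⊕ j} (unitary-mid {{e≢0}} 0<b (s≤s b≤i) e∣u)
      top : ∀ {e} → e ∈ D u → unitaryTerm (1⊕ j) N (p ^ suc i * e) ≡ suc j * unitaryTerm (1⊕ j) u e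
      top {e} e∈ with ∈D⇒∣ e∈
      ... | e∣u , e≢0 = unitaryTerm-scale {1⊕ j} {1⊕ j} {N} {u} {p ^ suc i * e} {e} (suc j)
                          (unitary-top (suc i) {{e≢0}} p∤u e∣u) (1⊕-p-part j (∤-∈D p∤u e∈) i)
      top-sum : block-sum (suc i) ≡ suc j * X
      top-sum = trans (sum-map-cong-∈ (D u) top) (sum-map-* (D u) (suc j) (unitaryTerm (1⊕ j) u))

  -- Divisor sums of 1⊕ⱼ: Σ_{d ∣ p^a·m} 1⊕ⱼ(d) = (1 + a(j+1)) · Σ_{d ∣ m} 1⊕ⱼ(d),
  -- since block 0 contributes F = Σ_{d ∣ m} 1⊕ⱼ(d) and each later block (j+1)·F.
  divisorSum-p-part : ∀ j {m} → ¬ p ∣ m → ∀ a →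
    divisorSum (1⊕ j) (p ^ a * m) ≡ suc (a * suc j) * divisorSum (1⊕ j) m
  divisorSum-p-part j {m} p∤m a = begin
    divisorSum (1⊕ j) (p ^ a * m)          ≡⟨ divisorSum-via-D (1⊕ j) (p ^ a * m) ⟩
    sum (map (1⊕ j) (D (p ^ a * m)))       ≡⟨ sum-over-p-part p∤m a (1⊕ j) ⟩
    Σ≤ a (λ b → sum (map (λ e → 1⊕ j (p ^ b * e)) (D m)))
                                           ≡⟨ Σ≤-head-rest a (sum-map-cong-∈ (D m) (λ {e} _ → cong (1⊕ j) (*-identityˡ e))) later ⟩
    F + a * (suc j * F)                    ≡⟨ solve 3 (λ f a k → f :+ a :* (k :* f) := (con 1 :+ a :* k) :* f) refl F a (suc j) ⟩
    suc (a * suc j) * F                    ≡⟨ cong (suc (a * suc j) *_) (divisorSum-via-D (1⊕ j) m) ⟨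
    suc (a * suc j) * divisorSum (1⊕ j) m  ∎
    where
      F = sum (map (1⊕ j) (D m))
      later : ∀ b → sum (map (λ e → 1⊕ j (p ^ suc b * e)) (D m)) ≡ suc j * F
      later b = trans (sum-map-cong-∈ (D m) (λ e∈ → 1⊕-p-part j (∤-∈D p∤m e∈) b)) (sum-map-* (D m) (suc j) (1⊕ j))

  σ₀-p-part : ∀ {m} → ¬ p ∣ m → ∀ a → σ₀ (p ^ a * m) ≡ suc a * σ₀ m
  σ₀-p-part {m} p∤m a = begin
    σ₀ (p ^ a * m)                   ≡⟨ σ₀-via-divisorSum (p ^ a * m) ⟩
    divisorSum one (p ^ a * m)       ≡⟨ divisorSum-p-part 0 p∤m a ⟩
    suc (a * 1) * divisorSum one m   ≡⟨ cong₂ (λ x y → suc x * y) (*-identityʳ a) (sym (σ₀-via-divisorSum m)) ⟩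
    suc a * σ₀ m                     ∎

  -- The identity Σ_{d ∣ n} 1⊕ⱼ(d) = σ₀(n^{j+1}) passes from m to p^a·m (p ∤ m):
  -- both sides get multiplied by 1 + a(j+1).
  identity-p-part : ∀ j {m} → ¬ p ∣ m → ∀ a → divisorSum (1⊕ j) m ≡ σ₀ (m ^ suc j) →
    divisorSum (1⊕ j) (p ^ a * m) ≡ σ₀ ((p ^ a * m) ^ suc j)
  identity-p-part j {m} p∤m a hyp = begin
    divisorSum (1⊕ j) (p ^ a * m)            ≡⟨ divisorSum-p-part j p∤m a ⟩
    suc (a * suc j) * divisorSum (1⊕ j) m    ≡⟨ cong (suc (a * suc j) *_) hyp ⟩
    suc (a * suc j) * σ₀ (m ^ suc j)         ≡⟨ σ₀-p-part (∤-^ p∤m (suc j)) (a * suc j) ⟨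
    σ₀ (p ^ (a * suc j) * m ^ suc j)         ≡⟨ cong (λ x → σ₀ (x * m ^ suc j)) (^-*-assoc p a (suc j)) ⟨
    σ₀ ((p ^ a) ^ suc j * m ^ suc j)         ≡⟨ cong σ₀ (^-distribʳ-* (p ^ a) m (suc j)) ⟨
    σ₀ ((p ^ a * m) ^ suc j)                 ∎

open AtPrime using (identity-p-part)

prime-divisor : ∀ n .{{_ : NonTrivial n}} → ∃[ p ] (Prime p × p ∣ n)
prime-divisor n@(suc (suc _)) with factorise n
... | record { factors = [] ; isFactorisation = () }
... | record { factors = p ∷ ps ; isFactorisation = n≡ ; factorsPrime = p-prime ∷ _ } =
  p , p-prime , divides (product ps) (trans n≡ (*-comm p (product ps)))

-- Σ_{d ∣ n} 1⊕ⱼ(d) = σ₀(n^{j+1}) for n ≥ 1, by strong induction on n: write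
-- n = p^a·m with p a prime divisor of n, a ≥ 1 and p ∤ m, so that m < n.
divisorSum-1⊕ : ∀ j n .{{_ : NonZero n}} → divisorSum (1⊕ j) n ≡ σ₀ (n ^ suc j)
divisorSum-1⊕ j (suc k) = <-rec P step (suc k)
  where
    P : ℕ → Set
    P n = {{NonZero n}} → divisorSum (1⊕ j) n ≡ σ₀ (n ^ suc j)
    step : ∀ n → (∀ {m} → m < n → P m) → P n
    step zero    _ {{()}}
    step (suc zero) _ = begin
      divisorSum (1⊕ j) 1 ≡⟨⟩
      1⊕ j 1 + 0          ≡⟨ +-identityʳ _ ⟩
      1⊕ j 1              ≡⟨ 1⊕-at-1 j ⟩
      1                   ≡⟨ cong σ₀ (^-zeroˡ (suc j)) ⟨
      σ₀ (1 ^ suc j)      ∎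
    step n@(suc (suc _)) rec with prime-divisor n
    ... | p , p-prime , p∣n with p-part p {{prime⇒nonTrivial p-prime}} n
    ...   | zero  , m , n≡ , p∤m = ⊥-elim (p∤m (subst (p ∣_) (trans n≡ (*-identityˡ m)) p∣n))
    ...   | suc a , m , n≡ , p∤m = subst (λ x → divisorSum (1⊕ j) x ≡ σ₀ (x ^ suc j)) (sym n≡)
            (identity-p-part p-prime j p∤m (suc a) (rec m<n))
      where
        instance
          m≢0 : NonZero m
          m≢0 = ∤⇒nonZero p∤m
        m<n : m < n
        m<n = subst (m <_) (trans (*-comm m (p ^ suc a)) (sym n≡))
                (m<m*n m (p ^ suc a) (^-monoʳ-< p (nonTrivial⇒n>1 p {{prime⇒nonTrivial p-prime}}) (z<s {n = a})))

mainTheorem11 : (k : ℕ) → 2 ≤ k → (n : ℕ) → 1 ≤ n →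
    divisorSum (τ* k) n ≡ σ₀ (n ^ k)
mainTheorem11 (suc (suc j)) (s≤s (s≤s z≤n)) n 1≤n = begin
  divisorSum (τ* (suc (suc j))) n  ≡⟨ divisorSum-cong (τ*≗1⊕ j) n ⟩
  divisorSum (1⊕ (suc j)) n        ≡⟨ divisorSum-1⊕ (suc j) n {{>-nonZero 1≤n}} ⟩
  σ₀ (n ^ suc (suc j))             ∎
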